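{- If $G$ is a Left dead end, then $\overline{1}+G=\{\cdot\mid G\}$.
   Context: All games are short partizan combinatorial game forms; $G+H$ is the disjunctive sum. Play is misère (a player unable to move wins). Misère outcome classes are ordered $\mathscr L>\mathscr P>\mathscr R$ and $\mathscr L>\mathscr N>\mathscr R$; $G\geq H$ means that for every game $X$ the misère outcome of $G+X$ is $\geq$ that of $H+X$, and $G=H$ means $G\ge H$ and $H\ge G$. A Left dead end is a game no subposition of which (including itself) has a Left option. $\{\cdot\mid G\}$ denotes the game with no Left options and sole Right option $G$, and $\overline{1}=\{\cdot\mid 0\}$ where $0=\{\cdot\mid\cdot\}$. -}

module Defs where

open import Data.Nat using (ℕ; zero; suc; _+_)
open import Data.Fin using (Fin; splitAt)
open import Data.Bool using (Bool; true; false; _∨_; not)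
open import Data.Sum using (_⊎_; inj₁; inj₂; [_,_])
open import Data.Product using (_×_)
open import Data.Empty using (⊥)

data Game : Set where
  mk : (nL : ℕ) → (Fin nL → Game) → (nR : ℕ) → (Fin nR → Game) → Game

noOpts : Fin 0 → Game
noOpts ()

zeroG : Game
zeroG = mk 0 noOpts 0 noOpts

rightOnly : Game → Game
rightOnly G = mk 0 noOpts 1 (λ _ → G)

oneBar : Game
oneBar = rightOnly zeroG

infixl 6 _⊕_
_⊕_ : Game → Game → Game
G@(mk nL gL nR gR) ⊕ H@(mk mL hL mR hR) =
  mk (nL + mL) (λ k → [ (λ i → gL i ⊕ H) , (λ j → G ⊕ hL j) ] (splitAt nL k))
     (nR + mR) (λ k → [ (λ i → gR i ⊕ H) , (λ j → G ⊕ hR j) ] (splitAt nR k))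

anyFin : (n : ℕ) → (Fin n → Bool) → Bool
anyFin zero f = false
anyFin (suc n) f = f Fin.zero ∨ anyFin n (λ i → f (Fin.suc i))

isZero : ℕ → Bool
isZero zero = true
isZero (suc _) = false

-- Misère play: a player unable to move wins.
-- leftWinsFirst G : Left wins G moving first.
-- rightWinsFirst G : Right wins G moving first.
leftWinsFirst  : Game → Bool
rightWinsFirst : Game → Bool
leftWinsFirst (mk nL gL nR gR) = isZero nL ∨ anyFin nL (λ i → not (rightWinsFirst (gL i)))
rightWinsFirst (mk nL gL nR gR) = isZero nR ∨ anyFin nR (λ j → not (leftWinsFirst (gR j)))

data Outcome : Set where
  𝓛 𝓝 𝓟 𝓡 : Outcome

outcomeOf : Bool → Bool → Outcome
outcomeOf true  true  = 𝓛   -- Left wins first, Right does not win first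
outcomeOf true  false = 𝓝
outcomeOf false true  = 𝓟
outcomeOf false false = 𝓡

outcome : Game → Outcome
outcome G = outcomeOf (leftWinsFirst G) (not (rightWinsFirst G))

-- Order on outcomes: 𝓛 > 𝓟 > 𝓡 and 𝓛 > 𝓝 > 𝓡 (reflexive-transitive closure)
data _≤O_ : Outcome → Outcome → Set where
  refl≤ : ∀ {o} → o ≤O o
  R≤    : ∀ {o} → 𝓡 ≤O o
  ≤L    : ∀ {o} → o ≤O 𝓛

_≥G_ : Game → Game → Set
G ≥G H = ∀ X → outcome (H ⊕ X) ≤O outcome (G ⊕ X)

_≡G_ : Game → Game → Set
G ≡G H = (G ≥G H) × (H ≥G G)

-- Left dead end: no subposition (including itself) has a Left option.
-- Since a Left dead end has no Left options, its subpositions are itself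
-- and the subpositions of its Right options.
LeftDeadEnd : Game → Set
LeftDeadEnd (mk zero gL nR gR) = ∀ j → LeftDeadEnd (gR j)
LeftDeadEnd (mk (suc _) gL nR gR) = ⊥

{-# OPTIONS --safe #-}
-- Compare 1̄ + G with {· | G} in every sum with a game X, for both players moving
-- first. Neither game has a Left option, so Left's moves are in X on both sides, as
-- are Right's moves in X, and induction on X applies. Right's remaining moves are to
-- 0 + G = G, matching his only other move in {· | G}, and to 1̄ + Gᴿ. The latter are
-- never better for him than the move to G: by induction on G, 1̄ + Gᴿ is at least
-- {· | Gᴿ}, and {· | Gᴿ} is at least G because a game without Left options only gets
-- better for Left when all but one of its Right options are removed.
module Submission where

open import Defs
open import Data.Bool using (Bool; true; false; not; _∨_; T)
open import Data.Bool.Properties using (T-∨)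
open import Data.Empty using (⊥-elim)
open import Data.Fin using (Fin; zero; suc; splitAt; _↑ˡ_; _↑ʳ_)
open import Data.Fin.Properties using (splitAt-↑ˡ; splitAt-↑ʳ)
open import Data.Nat using (ℕ; zero; suc; _+_)
open import Data.Product using (∃; ∃-syntax; _,_)
open import Data.Sum using (_⊎_; inj₁; inj₂; [_,_])
import Data.Sum as Sum
open import Data.Unit using (tt)
open import Function using (_∘_; case_of_; _⇔_; mk⇔; Equivalence)
open import Relation.Nullary.Negation using (¬_; contraposition)
open import Relation.Binary.PropositionalEquality using (_≡_; refl; subst; sym; cong; cong₂)

open Equivalence using (to; from)

T-not : ∀ {b} → T (not b) ⇔ (¬ T b)
T-not {false} = mk⇔ (λ _ ()) (λ _ → tt)
T-not {true}  = mk⇔ (λ ()) (λ ¬t → ¬t tt)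

T-anyFin : ∀ n {f : Fin n → Bool} → T (anyFin n f) ⇔ (∃[ i ] T (f i))
T-anyFin zero    = mk⇔ (λ ()) (λ { (() , _) })
T-anyFin (suc n) {f} = mk⇔ ⇒ ⇐
  where
  ⇒ : T (anyFin (suc n) f) → ∃[ i ] T (f i)
  ⇒ t with to T-∨ t
  ... | inj₁ t₀ = zero , t₀
  ... | inj₂ t₊ with to (T-anyFin n) t₊
  ...   | i , tᵢ = suc i , tᵢ
  ⇐ : ∃[ i ] T (f i) → T (anyFin (suc n) f)
  ⇐ (zero  , t) = from T-∨ (inj₁ t)
  ⇐ (suc i , t) = from T-∨ (inj₂ (from (T-anyFin n) (i , t)))

∃-[,] : ∀ {A B C : Set} (P : C → Set) {f : A → C} {g : B → C} s →
        P ([ f , g ] s) → ∃ (P ∘ f) ⊎ ∃ (P ∘ g)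
∃-[,] P (inj₁ a) p = inj₁ (a , p)
∃-[,] P (inj₂ b) p = inj₂ (b , p)

nLeft nRight : Game → ℕ
nLeft  (mk nL _ _ _) = nL
nRight (mk _ _ nR _) = nR

leftOption : (G : Game) → Fin (nLeft G) → Game
leftOption (mk _ gL _ _) = gL

rightOption : (G : Game) → Fin (nRight G) → Game
rightOption (mk _ _ _ gR) = gR

LeftDeadEnd⇒nLeft≡0 : ∀ G → LeftDeadEnd G → nLeft G ≡ 0
LeftDeadEnd⇒nLeft≡0 (mk zero    _ _ _) _ = refl
LeftDeadEnd⇒nLeft≡0 (mk (suc _) _ _ _) ()

T-leftWinsFirst : ∀ G → T (leftWinsFirst G) ⇔
                  (T (isZero (nLeft G)) ⊎ ∃[ i ] ¬ T (rightWinsFirst (leftOption G i)))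
T-leftWinsFirst (mk nL _ _ _) = mk⇔
  (Sum.map₂ (λ (i , t) → i , to T-not t) ∘ Sum.map₂ (to (T-anyFin nL)) ∘ to T-∨)
  (from T-∨ ∘ Sum.map₂ (from (T-anyFin nL) ∘ λ (i , ¬t) → i , from T-not ¬t))

T-rightWinsFirst : ∀ G → T (rightWinsFirst G) ⇔
                   (T (isZero (nRight G)) ⊎ ∃[ j ] ¬ T (leftWinsFirst (rightOption G j)))
T-rightWinsFirst (mk _ _ nR _) = mk⇔
  (Sum.map₂ (λ (j , t) → j , to T-not t) ∘ Sum.map₂ (to (T-anyFin nR)) ∘ to T-∨)
  (from T-∨ ∘ Sum.map₂ (from (T-anyFin nR) ∘ λ (j , ¬t) → j , from T-not ¬t))

leftWinsFirst-⊕-mono : ∀ P Q X → nLeft P ≡ 0 → nLeft Q ≡ 0 →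
  (∀ k → T (rightWinsFirst (P ⊕ leftOption X k)) → T (rightWinsFirst (Q ⊕ leftOption X k))) →
  T (leftWinsFirst (Q ⊕ X)) → T (leftWinsFirst (P ⊕ X))
leftWinsFirst-⊕-mono P@(mk _ _ _ _) Q@(mk _ _ _ _) X@(mk _ _ _ _) refl refl P⇒Q =
  from (T-leftWinsFirst (P ⊕ X)) ∘ Sum.map₂ (λ (k , ¬r) → k , contraposition (P⇒Q k) ¬r)
  ∘ to (T-leftWinsFirst (Q ⊕ X))

rightWinsFirst-⊕-introˡ : ∀ G X j →
  ¬ T (leftWinsFirst (rightOption G j ⊕ X)) → T (rightWinsFirst (G ⊕ X))
rightWinsFirst-⊕-introˡ G@(mk _ _ nR _) X@(mk _ _ mR _) j ¬l =
  from (T-rightWinsFirst (G ⊕ X)) (inj₂ (j ↑ˡ mR ,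
    subst (¬_ ∘ T ∘ leftWinsFirst) (sym (cong [ _ , _ ] (splitAt-↑ˡ nR j mR))) ¬l))

rightWinsFirst-⊕-introʳ : ∀ G X j →
  ¬ T (leftWinsFirst (G ⊕ rightOption X j)) → T (rightWinsFirst (G ⊕ X))
rightWinsFirst-⊕-introʳ G@(mk _ _ nR _) X@(mk _ _ mR _) j ¬l =
  from (T-rightWinsFirst (G ⊕ X)) (inj₂ (nR ↑ʳ j ,
    subst (¬_ ∘ T ∘ leftWinsFirst) (sym (cong [ _ , _ ] (splitAt-↑ʳ nR mR j))) ¬l))

rightWinsFirst-⊕-elim : ∀ G X → T (rightWinsFirst (G ⊕ X)) →
  T (isZero (nRight G + nRight X))
  ⊎ (∃[ i ] ¬ T (leftWinsFirst (rightOption G i ⊕ X)))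
  ⊎ (∃[ j ] ¬ T (leftWinsFirst (G ⊕ rightOption X j)))
rightWinsFirst-⊕-elim G@(mk _ _ nR _) X@(mk _ _ _ _) r with to (T-rightWinsFirst (G ⊕ X)) r
... | inj₁ none     = inj₁ none
... | inj₂ (k , ¬l) = inj₂ (∃-[,] (¬_ ∘ T ∘ leftWinsFirst) (splitAt nR k) ¬l)

infix 4 _≅_ _≽_

data _≅_ : Game → Game → Set where
  mk≅ : ∀ {nL gL hL nR gR hR} → (∀ i → gL i ≅ hL i) → (∀ j → gR j ≅ hR j) →
        mk nL gL nR gR ≅ mk nL hL nR hR

≅-sym : ∀ {A B} → A ≅ B → B ≅ A
≅-sym (mk≅ L≅ R≅) = mk≅ (≅-sym ∘ L≅) (≅-sym ∘ R≅)

[,]-≅ : ∀ {A B : Set} {f f′ : A → Game} {g g′ : B → Game} →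
        (∀ a → f a ≅ f′ a) → (∀ b → g b ≅ g′ b) → ∀ s → [ f , g ] s ≅ [ f′ , g′ ] s
[,]-≅ f≅ g≅ (inj₁ a) = f≅ a
[,]-≅ f≅ g≅ (inj₂ b) = g≅ b

⊕-identityˡ : ∀ G → zeroG ⊕ G ≅ G
⊕-identityˡ (mk _ gL _ gR) = mk≅ (⊕-identityˡ ∘ gL) (⊕-identityˡ ∘ gR)

⊕-congʳ : ∀ {A B} → A ≅ B → ∀ X → A ⊕ X ≅ B ⊕ X
⊕-congʳ {mk nL _ nR _} A≅B@(mk≅ L≅ R≅) X@(mk _ xL _ xR) = mk≅
  (λ k → [,]-≅ (λ i → ⊕-congʳ (L≅ i) X) (λ j → ⊕-congʳ A≅B (xL j)) (splitAt nL k))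
  (λ k → [,]-≅ (λ i → ⊕-congʳ (R≅ i) X) (λ j → ⊕-congʳ A≅B (xR j)) (splitAt nR k))

anyFin-cong : ∀ n {f g : Fin n → Bool} → (∀ i → f i ≡ g i) → anyFin n f ≡ anyFin n g
anyFin-cong zero    f≡g = refl
anyFin-cong (suc n) f≡g = cong₂ _∨_ (f≡g zero) (anyFin-cong n (f≡g ∘ suc))

≅⇒leftWinsFirst≡  : ∀ {A B} → A ≅ B → leftWinsFirst A ≡ leftWinsFirst B
≅⇒rightWinsFirst≡ : ∀ {A B} → A ≅ B → rightWinsFirst A ≡ rightWinsFirst B
≅⇒leftWinsFirst≡ {mk nL _ _ _} (mk≅ L≅ _) =
  cong (isZero nL ∨_) (anyFin-cong nL (cong not ∘ ≅⇒rightWinsFirst≡ ∘ L≅))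
≅⇒rightWinsFirst≡ {mk _ _ nR _} (mk≅ _ R≅) =
  cong (isZero nR ∨_) (anyFin-cong nR (cong not ∘ ≅⇒leftWinsFirst≡ ∘ R≅))

leftWinsFirst-zeroG⊕ : ∀ G X → leftWinsFirst ((zeroG ⊕ G) ⊕ X) ≡ leftWinsFirst (G ⊕ X)
leftWinsFirst-zeroG⊕ G X = ≅⇒leftWinsFirst≡ (⊕-congʳ (⊕-identityˡ G) X)

record _≽_ (A B : Game) : Set where
  field
    leftFirst  : T (leftWinsFirst B) → T (leftWinsFirst A)
    rightFirst : T (rightWinsFirst A) → T (rightWinsFirst B)
open _≽_

outcomeOf-mono : ∀ {l l′ r r′} → (T l → T l′) → (T r → T r′) → outcomeOf l r ≤O outcomeOf l′ r′
outcomeOf-mono {_}     {true}  {_}     {true}  _  _  = ≤L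
outcomeOf-mono {false} {_}     {false} {_}     _  _  = R≤
outcomeOf-mono {true}  {false} {_}     {_}     l⇒ _  = ⊥-elim (l⇒ tt)
outcomeOf-mono {_}     {_}     {true}  {false} _  r⇒ = ⊥-elim (r⇒ tt)
outcomeOf-mono {true}  {true}  {false} {false} _  _  = refl≤
outcomeOf-mono {false} {false} {true}  {true}  _  _  = refl≤

≽⇒outcome-≤ : ∀ {A B} → A ≽ B → outcome B ≤O outcome A
≽⇒outcome-≤ A≽B = outcomeOf-mono (leftFirst A≽B)
  (from T-not ∘ contraposition (rightFirst A≽B) ∘ to T-not)

≽⇒≥G : ∀ G H → (∀ X → G ⊕ X ≽ H ⊕ X) → G ≥G H
≽⇒≥G G H G≽H X = ≽⇒outcome-≤ (G≽H X)

rightOnly-rightOption-≽ : ∀ G → nLeft G ≡ 0 → ∀ j X → rightOnly (rightOption G j) ⊕ X ≽ G ⊕ X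
rightOnly-rightOption-≽ G@(mk _ _ _ _) refl j X@(mk _ xL _ xR) = record
  { leftFirst  = leftWinsFirst-⊕-mono (rightOnly (rightOption G j)) G X refl refl
                   (λ k → rightFirst (rightOnly-rightOption-≽ G refl j (xL k)))
  ; rightFirst = λ r → case rightWinsFirst-⊕-elim (rightOnly (rightOption G j)) X r of λ where
      (inj₁ ())
      (inj₂ (inj₁ (zero , ¬l))) → rightWinsFirst-⊕-introˡ G X j ¬l
      (inj₂ (inj₂ (k , ¬l)))    → rightWinsFirst-⊕-introʳ G X k
        (contraposition (leftFirst (rightOnly-rightOption-≽ G refl j (xR k))) ¬l)
  }

rightOnly-≽-oneBar⊕ : ∀ G → nLeft G ≡ 0 → ∀ X → rightOnly G ⊕ X ≽ (oneBar ⊕ G) ⊕ X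
rightOnly-≽-oneBar⊕ G@(mk _ _ _ _) refl X@(mk _ xL _ xR) = record
  { leftFirst  = leftWinsFirst-⊕-mono (rightOnly G) (oneBar ⊕ G) X refl refl
                   (λ k → rightFirst (rightOnly-≽-oneBar⊕ G refl (xL k)))
  ; rightFirst = λ r → case rightWinsFirst-⊕-elim (rightOnly G) X r of λ where
      (inj₁ ())
      (inj₂ (inj₁ (zero , ¬l))) → rightWinsFirst-⊕-introˡ (oneBar ⊕ G) X zero
        (subst (¬_ ∘ T) (sym (leftWinsFirst-zeroG⊕ G X)) ¬l)
      (inj₂ (inj₂ (k , ¬l)))    → rightWinsFirst-⊕-introʳ (oneBar ⊕ G) X k
        (contraposition (leftFirst (rightOnly-≽-oneBar⊕ G refl (xR k))) ¬l)
  }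

oneBar⊕-≽-rightOnly-step : ∀ G → nLeft G ≡ 0 →
  (∀ i X → (oneBar ⊕ rightOption G i) ⊕ X ≽ rightOnly (rightOption G i) ⊕ X) →
  ∀ X → (oneBar ⊕ G) ⊕ X ≽ rightOnly G ⊕ X
oneBar⊕-≽-rightOnly-step G@(mk _ _ _ _) refl ih X@(mk _ xL _ xR) = record
  { leftFirst  = leftWinsFirst-⊕-mono (oneBar ⊕ G) (rightOnly G) X refl refl
                   (λ k → rightFirst (oneBar⊕-≽-rightOnly-step G refl ih (xL k)))
  ; rightFirst = λ r → case rightWinsFirst-⊕-elim (oneBar ⊕ G) X r of λ where
      (inj₁ ())
      (inj₂ (inj₁ (zero , ¬l)))  → rightWinsFirst-⊕-introˡ (rightOnly G) X zero
        (subst (¬_ ∘ T) (leftWinsFirst-zeroG⊕ G X) ¬l)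
      (inj₂ (inj₁ (suc i , ¬l))) → rightWinsFirst-⊕-introˡ (rightOnly G) X zero
        (contraposition (leftFirst (ih i X) ∘ leftFirst (rightOnly-rightOption-≽ G refl i X))
                        ¬l)
      (inj₂ (inj₂ (k , ¬l)))     → rightWinsFirst-⊕-introʳ (rightOnly G) X k
        (contraposition (leftFirst (oneBar⊕-≽-rightOnly-step G refl ih (xR k))) ¬l)
  }

oneBar⊕-≽-rightOnly : ∀ G → LeftDeadEnd G → ∀ X → (oneBar ⊕ G) ⊕ X ≽ rightOnly G ⊕ X
oneBar⊕-≽-rightOnly G@(mk zero _ _ gR) dead =
  oneBar⊕-≽-rightOnly-step G refl (λ i → oneBar⊕-≽-rightOnly (gR i) (dead i))
oneBar⊕-≽-rightOnly (mk (suc _) _ _ _) ()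

mainTheorem7 : (G : Game) → LeftDeadEnd G → (oneBar ⊕ G) ≡G rightOnly G
mainTheorem7 G dead =
    ≽⇒≥G (oneBar ⊕ G) (rightOnly G) (oneBar⊕-≽-rightOnly G dead)
  , ≽⇒≥G (rightOnly G) (oneBar ⊕ G) (rightOnly-≽-oneBar⊕ G (LeftDeadEnd⇒nLeft≡0 G dead))
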